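{- Let $A$ be a Nakayama algebra of finite global dimension. Then the magnitude $m_A$ equals the number of simple $A$-modules of even projective dimension, and also equals the number of vertices lying on a cycle in the resolution quiver of $A$.
   Context: $K$ is an algebraically closed field; a Nakayama algebra is a finite-dimensional (connected) algebra $KQ/I$, $I$ admissible, with $Q$ either the linear quiver $0\to\cdots\to n-1$ or the cyclic quiver $0\to 1\to\cdots\to n-1\to 0$ (so every indecomposable module is uniserial). Its Kupisch series is $[c_0,\dots,c_{n-1}]$ with $c_i=\dim_K e_iA$. The resolution quiver of $A$ has vertex set $\mathbb Z/n\mathbb Z$ and an arrow $i\to j$ whenever $j\equiv i+c_i \pmod n$. The Cartan matrix of $A$ is the $n\times n$ matrix with entries $\dim_K e_iAe_j$; for $A$ of finite global dimension it is invertible, and the magnitude $m_A$ is the sum of all entries of its inverse. -}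

module Defs where

open import Data.Nat as ℕ using (ℕ; zero; suc; _+_; _∸_; _≤_; _<_; NonZero)
open import Data.Nat.DivMod using (_%_; _mod_)
open import Data.Fin as Fin using (Fin; toℕ)
open import Data.Fin.Subset using (Subset; _∈_; ∣_∣)
open import Data.Integer using (+_)
open import Data.Rational as ℚ using (ℚ; 0ℚ; 1ℚ; _/_)
open import Data.Product using (Σ; ∃; _×_)
open import Relation.Binary.PropositionalEquality using (_≡_)
open import Relation.Nullary using (yes; no)
open import Function.Bundles using (_⇔_)

shift : ∀ {n} .{{_ : NonZero n}} → Fin n → ℕ → Fin n
shift {n} i k = (toℕ i + k) mod n

-- Kupisch series c (c i = dim e_i A, P_i = e_i A has composition
-- factors S_i, S_{i+1}, …, S_{i+c_i-1}) of a connected Nakayama algebra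
-- KQ/I with I admissible.
data Kupisch {n : ℕ} .{{_ : NonZero n}} (c : Fin n → ℕ) : Set where
  -- cyclic quiver 0 → 1 → ⋯ → n-1 → 0
  cyclic : (∀ i → 2 ≤ c i)
         → (∀ i → c i ∸ 1 ≤ c (shift i 1))
         → Kupisch c
  -- linear quiver 0 → 1 → ⋯ → n-1
  linear : (∀ i → suc (toℕ i) < n → 2 ≤ c i)
         → (∀ i → suc (toℕ i) ≡ n → c i ≡ 1)
         → (∀ i → c i ∸ 1 ≤ c (shift i 1))
         → Kupisch c

-- The indecomposable (uniserial) module M i ℓ (1 ≤ ℓ ≤ c i) has top S_i and
-- composition factors S_i, …, S_{i+ℓ-1}; its projective cover is P_i = M i (c i)
-- and its first syzygy (for ℓ < c i) is M (i+ℓ) (c i ∸ ℓ).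
-- PD c i ℓ d : the module M i ℓ has projective dimension d.
data PD {n : ℕ} .{{_ : NonZero n}} (c : Fin n → ℕ) : Fin n → ℕ → ℕ → Set where
  pd-proj : ∀ {i ℓ} → ℓ ≡ c i → PD c i ℓ zero
  pd-step : ∀ {i ℓ d} → ℓ < c i → PD c (shift i ℓ) (c i ∸ ℓ) d → PD c i ℓ (suc d)

-- Cartan matrix: entry (i , j) = dim e_i A e_j = multiplicity of S_j in P_i.
countHits : ∀ {n} .{{_ : NonZero n}} → Fin n → Fin n → ℕ → ℕ
countHits i j zero = zero
countHits i j (suc k) with shift i k Fin.≟ j
... | yes _ = suc (countHits i j k)
... | no _ = countHits i j k

cartan : ∀ {n} .{{_ : NonZero n}} → (Fin n → ℕ) → Fin n → Fin n → ℕ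
cartan c i j = countHits i j (c i)

sumℚ : ∀ {n} → (Fin n → ℚ) → ℚ
sumℚ {zero} f = 0ℚ
sumℚ {suc n} f = f Fin.zero ℚ.+ sumℚ (λ i → f (Fin.suc i))

ℕ→ℚ : ℕ → ℚ
ℕ→ℚ k = + k / 1

Matrix : ℕ → Set
Matrix n = Fin n → Fin n → ℚ

toℚMatrix : ∀ {n} → (Fin n → Fin n → ℕ) → Matrix n
toℚMatrix C i j = ℕ→ℚ (C i j)

_⊛_ : ∀ {n} → Matrix n → Matrix n → Matrix n
(M ⊛ N) i j = sumℚ (λ k → M i k ℚ.* N k j)

identity : ∀ {n} → Matrix n
identity i j with i Fin.≟ j
... | yes _ = 1ℚ
... | no _ = 0ℚ

IsInverse : ∀ {n} → Matrix n → Matrix n → Set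
IsInverse C M = (∀ i j → (C ⊛ M) i j ≡ identity i j) × (∀ i j → (M ⊛ C) i j ≡ identity i j)

-- magnitude: sum of all entries of a matrix (applied to the inverse Cartan matrix)
entrySum : ∀ {n} → Matrix n → ℚ
entrySum M = sumℚ (λ i → sumℚ (λ j → M i j))

countEven : ∀ {n} → (Fin n → ℕ) → ℕ
countEven {zero} f = zero
countEven {suc n} f with f Fin.zero % 2 ℕ.≟ 0
... | yes _ = suc (countEven (λ i → f (Fin.suc i)))
... | no _ = countEven (λ i → f (Fin.suc i))

-- resolution quiver: i → i + c i (mod n)
resStep : ∀ {n} .{{_ : NonZero n}} → (Fin n → ℕ) → Fin n → Fin n
resStep c i = shift i (c i)

iter : ∀ {A : Set} → (A → A) → ℕ → A → A
iter f zero x = x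
iter f (suc m) x = f (iter f m x)

OnCycle : ∀ {n} .{{_ : NonZero n}} → (Fin n → ℕ) → Fin n → Set
OnCycle c i = ∃ λ m → iter (resStep c) (suc m) i ≡ i

-- Lift everything to the universal cover ℕ → ℤ/nℤ, y ↦ y mod n.  There the resolution quiver
-- becomes the strictly increasing map ρ y = y + c (y mod n), and a uniserial module is an interval
-- [a, b) with projective cover [a, ρ a) and syzygy [b, ρ a).  Following the minimal resolution of
-- the simple [y, y + 1) gives, for any B bounding all projective dimensions,
--   ρ^B (y + 1) = ρ^(ε y) (ρ^B y),   ε y = 1 if pd S_y is even and 0 otherwise.
-- With this relation the alternating sums of projectives along these resolutions form a two-sided
-- inverse of the Cartan matrix (both products telescope) whose row sums are the ε y, so the
-- magnitude counts the simples of even projective dimension.  Iterating the relation, ρ^B maps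
-- [0, n) onto the orbit segment y₀, ρ y₀, …, ρ^(s-1) y₀, where y₀ = ρ^B 0, s = Σ ε y and
-- ρ^s y₀ = y₀ + n.  These s points lie in a window of length n, hence are distinct mod n, and
-- modulo n they are exactly the vertices on cycles of the resolution quiver.

{-# OPTIONS --safe #-}
module Submission where

open import Defs
open import Data.Nat using (ℕ; NonZero)
open import Data.Fin using (Fin)
open import Data.Fin.Subset using (Subset; _∈_; ∣_∣)
open import Data.Rational using (ℚ)
open import Data.Product using (Σ; ∃; _×_)
open import Relation.Binary.PropositionalEquality using (_≡_)
open import Function.Bundles using (_⇔_)
open import Data.Nat using (_≤_; _<_; suc; z≤n; s≤s; _<?_)
open import Data.Nat.Properties using (≤-trans; ≤-reflexive; ≤-antisym; ≮⇒≥)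
open import Data.Fin using (toℕ)
open import Data.Fin.Properties using (toℕ<n)
import Data.List as List
open import Data.List.Extrema.Nat using (max; xs≤max)
open import Data.List.Relation.Unary.All.Properties using (tabulate⁻)
open import Data.Product using (_,_)
open import Relation.Nullary using (yes; no)
open import Relation.Binary.PropositionalEquality using (sym; trans; cong)

module Iteration where
  open import Data.Nat using (zero; suc; _+_; _*_)
  open import Data.Nat.Properties using (+-comm; *-suc)
  open import Data.Nat.DivMod using (_%_; _/_; m≡m%n+[m/n]*n)
  open import Data.Product using (_,_)
  open import Relation.Binary.PropositionalEquality using (refl; sym; trans; cong; module ≡-Reasoning)
  open ≡-Reasoning

  module _ {A : Set} (f : A → A) where

    iter-+ : ∀ m k x → iter f (m + k) x ≡ iter f m (iter f k x)
    iter-+ zero    k x = refl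
    iter-+ (suc m) k x = cong f (iter-+ m k x)

    iter-suc : ∀ m x → iter f m (f x) ≡ f (iter f m x)
    iter-suc zero    x = refl
    iter-suc (suc m) x = cong f (iter-suc m x)

    iter-comm : ∀ m k x → iter f m (iter f k x) ≡ iter f k (iter f m x)
    iter-comm m k x = begin
      iter f m (iter f k x) ≡⟨ iter-+ m k x ⟨
      iter f (m + k) x      ≡⟨ cong (λ l → iter f l x) (+-comm m k) ⟩
      iter f (k + m) x      ≡⟨ iter-+ k m x ⟩
      iter f k (iter f m x) ∎

    module _ {p x} (fixed : iter f p x ≡ x) where

      iter-*-fixed : ∀ q → iter f (q * p) x ≡ x
      iter-*-fixed zero    = refl
      iter-*-fixed (suc q) = begin
        iter f (p + q * p) x      ≡⟨ iter-+ p (q * p) x ⟩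
        iter f p (iter f (q * p) x) ≡⟨ cong (iter f p) (iter-*-fixed q) ⟩
        iter f p x                ≡⟨ fixed ⟩
        x                         ∎

      iter-%-fixed : .{{_ : NonZero p}} → ∀ r → iter f r x ≡ iter f (r % p) x
      iter-%-fixed r = begin
        iter f r x                             ≡⟨ cong (λ l → iter f l x) (m≡m%n+[m/n]*n r p) ⟩
        iter f (r % p + r / p * p) x           ≡⟨ iter-+ (r % p) (r / p * p) x ⟩
        iter f (r % p) (iter f (r / p * p) x)  ≡⟨ cong (iter f (r % p)) (iter-*-fixed (r / p)) ⟩
        iter f (r % p) x                       ∎

      iter-fixed-orbit : ∀ t → iter f p (iter f t x) ≡ iter f t x
      iter-fixed-orbit t = trans (iter-comm p t x) (cong (iter f t) fixed)

    iter-returns : ∀ {m i} → iter f (suc m) i ≡ i → ∀ K → ∃ λ r → iter f r (iter f K i) ≡ i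
    iter-returns {m} {i} fixed K = K * m , (begin
      iter f (K * m) (iter f K i) ≡⟨ iter-+ (K * m) K i ⟨
      iter f (K * m + K) i        ≡⟨ cong (λ l → iter f l i) (trans (+-comm (K * m) K) (sym (*-suc K m))) ⟩
      iter f (K * suc m) i        ≡⟨ iter-*-fixed fixed K ⟩
      i                           ∎)

module Counting where
  open import Data.Nat using (zero; suc; _+_; _<_; _≤_; z≤n; s≤s; _≟_)
  open import Data.Nat.Properties as ℕP using (≤-refl; m<n⇒m<1+n; m≤n⇒m<n∨m≡n)
  open import Data.Nat.DivMod using (_%_)
  open import Data.Fin using (zero; suc; toℕ)
  open import Data.Fin.Subset using (⊥; ⁅_⁆; _∪_; _∉_; inside; outside)
  open import Data.Fin.Subset.Properties using (∉⊥; x∈⁅x⁆; x∈⁅y⁆⇒x≡y; x∈p∪q⁺; x∈p∪q⁻; ∪-identityˡ; ∣⊥∣≡0)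
  open import Data.Vec using (_∷_; here; there)
  open import Data.Product using (_,_)
  open import Data.Sum using (inj₁; inj₂)
  open import Function using (_∘_)
  open import Relation.Nullary using (yes; no; contradiction)
  open import Relation.Binary.PropositionalEquality using (refl; sym; trans; cong; cong₂; _≢_)
  open import Algebra.Properties.CommutativeMonoid.Sum ℕP.+-0-commutativeMonoid
    using () renaming (sum to sumℕ)

  ∑ℕ< : ℕ → (ℕ → ℕ) → ℕ
  ∑ℕ< L w = sumℕ (λ (x : Fin L) → w (toℕ x))

  evenIndicator : ℕ → ℕ
  evenIndicator zero          = 1
  evenIndicator (suc zero)    = 0
  evenIndicator (suc (suc d)) = evenIndicator d

  evenIndicator≤1 : ∀ d → evenIndicator d ≤ 1
  evenIndicator≤1 zero          = s≤s z≤n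
  evenIndicator≤1 (suc zero)    = z≤n
  evenIndicator≤1 (suc (suc d)) = evenIndicator≤1 d

  -- (2 + d) % 2 reduces to d % 2, so the recursive calls typecheck as they stand.
  evenIndicator-even : ∀ d → d % 2 ≡ 0 → evenIndicator d ≡ 1
  evenIndicator-even zero          _    = refl
  evenIndicator-even (suc (suc d)) even = evenIndicator-even d even

  evenIndicator-odd : ∀ d → d % 2 ≢ 0 → evenIndicator d ≡ 0
  evenIndicator-odd zero          odd = contradiction refl odd
  evenIndicator-odd (suc zero)    _   = refl
  evenIndicator-odd (suc (suc d)) odd = evenIndicator-odd d odd

  countEven≡sum : ∀ {m} (f : Fin m → ℕ) → countEven f ≡ sumℕ (λ i → evenIndicator (f i))
  countEven≡sum {zero}  f = refl
  countEven≡sum {suc m} f with f zero % 2 ≟ 0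
  ... | yes even = cong₂ _+_ (sym (evenIndicator-even (f zero) even)) (countEven≡sum (f ∘ suc))
  ... | no  odd  = cong₂ _+_ (sym (evenIndicator-odd (f zero) odd)) (countEven≡sum (f ∘ suc))

  image : ∀ {n} → (ℕ → Fin n) → ℕ → Subset n
  image f zero    = ⊥
  image f (suc s) = ⁅ f s ⁆ ∪ image f s

  module _ {n} {f : ℕ → Fin n} where

    ∈-image⁺ : ∀ {s t} → t < s → f t ∈ image f s
    ∈-image⁺ {suc s} (s≤s t≤s) with m≤n⇒m<n∨m≡n t≤s
    ... | inj₁ t<s  = x∈p∪q⁺ (inj₂ (∈-image⁺ t<s))
    ... | inj₂ refl = x∈p∪q⁺ (inj₁ (x∈⁅x⁆ (f s)))

    ∈-image⁻ : ∀ {s i} → i ∈ image f s → ∃ λ t → t < s × f t ≡ i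
    ∈-image⁻ {zero}  i∈⊥ = contradiction i∈⊥ ∉⊥
    ∈-image⁻ {suc s} i∈ with x∈p∪q⁻ ⁅ f s ⁆ (image f s) i∈
    ... | inj₁ i∈⁅fs⁆ = s , ≤-refl , sym (x∈⁅y⁆⇒x≡y (f s) i∈⁅fs⁆)
    ... | inj₂ i∈img with ∈-image⁻ i∈img
    ...   | t , t<s , ft≡i = t , m<n⇒m<1+n t<s , ft≡i

  ∣⁅x⁆∪p∣ : ∀ {n} {x : Fin n} {p : Subset n} → x ∉ p → ∣ ⁅ x ⁆ ∪ p ∣ ≡ suc ∣ p ∣
  ∣⁅x⁆∪p∣ {x = zero}  {outside ∷ p} _   = cong (suc ∘ ∣_∣) (∪-identityˡ p)
  ∣⁅x⁆∪p∣ {x = zero}  {inside  ∷ p} x∉p = contradiction here x∉p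
  ∣⁅x⁆∪p∣ {x = suc x} {outside ∷ p} x∉p = ∣⁅x⁆∪p∣ (x∉p ∘ there)
  ∣⁅x⁆∪p∣ {x = suc x} {inside  ∷ p} x∉p = cong suc (∣⁅x⁆∪p∣ (x∉p ∘ there))

  ∣image∣ : ∀ {n} {f : ℕ → Fin n} {s} → (∀ {t t'} → t < t' → t' < s → f t ≢ f t') → ∣ image f s ∣ ≡ s
  ∣image∣ {n} {s = zero}  _        = ∣⊥∣≡0 n
  ∣image∣ {f = f} {s = suc s} distinct =
    trans (∣⁅x⁆∪p∣ fs∉) (cong suc (∣image∣ (λ t<t' t'<s → distinct t<t' (m<n⇒m<1+n t'<s))))
    where
    fs∉ : f s ∉ image f s
    fs∉ fs∈ with ∈-image⁻ fs∈
    ... | t , t<s , ft≡fs = distinct t<s ≤-refl ft≡fs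

module Cover {n : ℕ} .{{_ : NonZero n}} (c : Fin n → ℕ) where
  open import Data.Nat using (zero; suc; _+_; _*_; _∸_; _≤_; _<_; _≤′_; s≤s; ≤′-refl; ≤′-step; _≟_; ≢-nonZero)
  open import Data.Nat.Properties
    using (+-assoc; +-comm; +-suc; +-identityʳ; ≤-refl; ≤-trans; ≤-antisym; <⇒≤; <⇒≢; <-≤-trans; ≤⇒≤′;
           <-cmp; m<m+n; m+[n∸m]≡n; m∸n≡0⇒m≤n; ∸-monoˡ-<; m+n∸m≡n; [m+n]∸[m+o]≡n∸o; *-distribʳ-∸)
  open import Data.Nat.DivMod
    using (_%_; _/_; _mod_; m%n<n; m<n⇒m%n≡m; [m+n]%n≡m%n; %-distribˡ-+; m%n%n≡m%n; m≡m%n+[m/n]*n)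
  open import Data.Nat.Divisibility using (_∣_; divides; >⇒∤)
  open import Data.Fin using (toℕ)
  open import Data.Fin.Properties using (toℕ-fromℕ<; fromℕ<-cong; fromℕ<-toℕ; toℕ<n)
  open import Function using (_∘_)
  open import Relation.Binary.Definitions using (tri<; tri≈; tri>)
  open import Relation.Nullary using (yes; no; contradiction)
  open import Relation.Binary.PropositionalEquality using (refl; sym; trans; cong; cong₂; subst; module ≡-Reasoning)
  open import Algebra.Properties.CommutativeMonoid.Sum Data.Nat.Properties.+-0-commutativeMonoid
    using () renaming (sum-cong-≗ to sumℕ-cong-≗)
  open import Algebra.Properties.CommutativeSemigroup Data.Nat.Properties.+-commutativeSemigroup
    using (xy∙z≈xz∙y)
  open ≡-Reasoning
  open Iteration
  open Counting using (∑ℕ<; evenIndicator)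

  vertex : ℕ → Fin n
  vertex y = y mod n

  toℕ-vertex : ∀ y → toℕ (vertex y) ≡ y % n
  toℕ-vertex y = toℕ-fromℕ< (m%n<n y n)

  vertex-cong : ∀ {y y'} → y % n ≡ y' % n → vertex y ≡ vertex y'
  vertex-cong {y} {y'} eq = fromℕ<-cong (y % n) (y' % n) eq (m%n<n y n) (m%n<n y' n)

  vertex-toℕ : ∀ i → vertex (toℕ i) ≡ i
  vertex-toℕ i = trans (fromℕ<-cong _ (toℕ i) (m<n⇒m%n≡m (toℕ<n i)) (m%n<n (toℕ i) n) (toℕ<n i))
                       (fromℕ<-toℕ i (toℕ<n i))

  vertex-+ : ∀ y k → vertex (y + k) ≡ shift (vertex y) k
  vertex-+ y k = vertex-cong (begin
    (y + k) % n                  ≡⟨ %-distribˡ-+ y k n ⟩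
    (y % n + k % n) % n          ≡⟨ cong (λ r → (r + k % n) % n) (m%n%n≡m%n y n) ⟨
    (y % n % n + k % n) % n      ≡⟨ %-distribˡ-+ (y % n) k n ⟨
    (y % n + k) % n              ≡⟨ cong (λ r → (r + k) % n) (toℕ-vertex y) ⟨
    (toℕ (vertex y) + k) % n     ∎)

  vertex-+n : ∀ y → vertex (y + n) ≡ vertex y
  vertex-+n y = vertex-cong ([m+n]%n≡m%n y n)

  vertex-injective-window : ∀ {u v} → u ≤ v → v < u + n → vertex u ≡ vertex v → u ≡ v
  vertex-injective-window {u} {v} u≤v v<u+n eq with v ∸ u ≟ 0
  ... | yes v∸u≡0 = ≤-antisym u≤v (m∸n≡0⇒m≤n v∸u≡0)
  ... | no  v∸u≢0 = contradiction n∣v∸u (>⇒∤ {{≢-nonZero v∸u≢0}} v∸u<n)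
    where
    u%n≡v%n : u % n ≡ v % n
    u%n≡v%n = trans (sym (toℕ-vertex u)) (trans (cong toℕ eq) (toℕ-vertex v))
    v∸u<n : v ∸ u < n
    v∸u<n = subst (v ∸ u <_) (m+n∸m≡n u n) (∸-monoˡ-< v<u+n u≤v)
    n∣v∸u : n ∣ v ∸ u
    n∣v∸u = divides (v / n ∸ u / n) (begin
      v ∸ u                                      ≡⟨ cong₂ _∸_ (m≡m%n+[m/n]*n v n) (m≡m%n+[m/n]*n u n) ⟩
      (v % n + v / n * n) ∸ (u % n + u / n * n)  ≡⟨ cong (λ r → (v % n + v / n * n) ∸ (r + u / n * n)) u%n≡v%n ⟩
      (v % n + v / n * n) ∸ (v % n + u / n * n)  ≡⟨ [m+n]∸[m+o]≡n∸o (v % n) (v / n * n) (u / n * n) ⟩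
      v / n * n ∸ u / n * n                      ≡⟨ *-distribʳ-∸ n (v / n) (u / n) ⟨
      (v / n ∸ u / n) * n                        ∎)

  ρ : ℕ → ℕ
  ρ y = y + c (vertex y)

  ρ^ : ℕ → ℕ → ℕ
  ρ^ = iter ρ

  iter-resStep-vertex : ∀ m y → iter (resStep c) m (vertex y) ≡ vertex (ρ^ m y)
  iter-resStep-vertex zero    y = refl
  iter-resStep-vertex (suc m) y =
    trans (cong (resStep c) (iter-resStep-vertex m y)) (sym (vertex-+ (ρ^ m y) _))

  ρ-+n : ∀ y → ρ (y + n) ≡ ρ y + n
  ρ-+n y = trans (cong (λ i → y + n + c i) (vertex-+n y)) (xy∙z≈xz∙y y n (c (vertex y)))

  ρ^-+n : ∀ m y → ρ^ m (y + n) ≡ ρ^ m y + n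
  ρ^-+n zero    y = refl
  ρ^-+n (suc m) y = trans (cong ρ (ρ^-+n m y)) (ρ-+n (ρ^ m y))

  -- IntervalPD d a b: the module [a, b) of the cover, with composition factors S_a, …, S_(b-1),
  -- has projective dimension d; the recursion is along its syzygy [b, ρ a).
  IntervalPD : ℕ → ℕ → ℕ → Set
  IntervalPD zero    a b = b ≡ ρ a
  IntervalPD (suc d) a b = IntervalPD d b (ρ a)

  PD⇒IntervalPD : ∀ {i ℓ d} → PD c i ℓ d → ∀ a → vertex a ≡ i → IntervalPD d a (a + ℓ)
  PD⇒IntervalPD (pd-proj ℓ≡cᵢ) a refl = cong (a +_) ℓ≡cᵢ
  PD⇒IntervalPD (pd-step {ℓ = ℓ} {d} ℓ<cᵢ pd) a refl =
    subst (IntervalPD d (a + ℓ)) a+ℓ+[cᵢ∸ℓ]≡ρa (PD⇒IntervalPD pd (a + ℓ) (vertex-+ a ℓ))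
    where
    a+ℓ+[cᵢ∸ℓ]≡ρa : a + ℓ + (c (vertex a) ∸ ℓ) ≡ ρ a
    a+ℓ+[cᵢ∸ℓ]≡ρa = trans (+-assoc a ℓ _) (cong (a +_) (m+[n∸m]≡n (<⇒≤ ℓ<cᵢ)))

  IntervalPD⇒ρ^ : ∀ d {a b K} → IntervalPD d a b → d ≤ K → ρ^ K b ≡ ρ^ (evenIndicator d) (ρ^ K a)
  IntervalPD⇒ρ^ zero {a} {K = K} refl _ = iter-suc ρ K a
  IntervalPD⇒ρ^ (suc d) {K = zero} _ ()
  IntervalPD⇒ρ^ (suc zero) {a} {b} {suc K} ρa≡ρb _ = begin
    ρ^ (suc K) b  ≡⟨ iter-suc ρ K b ⟨
    ρ^ K (ρ b)    ≡⟨ cong (ρ^ K) ρa≡ρb ⟨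
    ρ^ K (ρ a)    ≡⟨ iter-suc ρ K a ⟩
    ρ^ (suc K) a  ∎
  IntervalPD⇒ρ^ (suc (suc d)) {a} {b} {suc K} pd (s≤s d<K) = begin
    ρ^ (suc K) b                         ≡⟨ iter-suc ρ K b ⟨
    ρ^ K (ρ b)                           ≡⟨ IntervalPD⇒ρ^ d pd (<⇒≤ d<K) ⟩
    ρ^ (evenIndicator d) (ρ^ K (ρ a))    ≡⟨ cong (ρ^ (evenIndicator d)) (iter-suc ρ K a) ⟩
    ρ^ (evenIndicator d) (ρ^ (suc K) a)  ∎

  module Inflationary (c-pos : ∀ i → 0 < c i) where

    ρ-inflationary : ∀ y → y < ρ y
    ρ-inflationary y = m<m+n y (c-pos (vertex y))

    ρ^-monoˡ-≤ : ∀ {m m'} y → m ≤′ m' → ρ^ m y ≤ ρ^ m' y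
    ρ^-monoˡ-≤ y ≤′-refl          = ≤-refl
    ρ^-monoˡ-≤ y (≤′-step m≤′m') = ≤-trans (ρ^-monoˡ-≤ y m≤′m') (<⇒≤ (ρ-inflationary _))

    ρ^-monoˡ-< : ∀ {m m'} y → m < m' → ρ^ m y < ρ^ m' y
    ρ^-monoˡ-< y m<m' = <-≤-trans (ρ-inflationary _) (ρ^-monoˡ-≤ y (≤⇒≤′ m<m'))

    ρ^-injectiveˡ : ∀ {m m'} y → ρ^ m y ≡ ρ^ m' y → m ≡ m'
    ρ^-injectiveˡ {m} {m'} y eq with <-cmp m m'
    ... | tri< m<m' _ _ = contradiction eq (<⇒≢ (ρ^-monoˡ-< y m<m'))
    ... | tri≈ _ m≡m' _ = m≡m'
    ... | tri> _ _ m'<m = contradiction (sym eq) (<⇒≢ (ρ^-monoˡ-< y m'<m))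

  module Resolutions (pd : Fin n → ℕ) (pd-res : ∀ i → PD c i 1 (pd i)) (B : ℕ) (pd≤B : ∀ i → pd i ≤ B) where

    ε : Fin n → ℕ
    ε i = evenIndicator (pd i)

    ρ^B-suc : ∀ y → ρ^ B (suc y) ≡ ρ^ (ε (vertex y)) (ρ^ B y)
    ρ^B-suc y = subst (λ z → ρ^ B z ≡ ρ^ (ε (vertex y)) (ρ^ B y)) (+-comm y 1)
      (IntervalPD⇒ρ^ (pd (vertex y)) (PD⇒IntervalPD (pd-res (vertex y)) y refl) (pd≤B (vertex y)))

    evensIn : ℕ → ℕ → ℕ
    evensIn a L = ∑ℕ< L (λ x → ε (vertex (a + x)))

    evensIn-suc : ∀ a L → evensIn a (suc L) ≡ ε (vertex a) + evensIn (suc a) L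
    evensIn-suc a L = cong₂ _+_ (cong (ε ∘ vertex) (+-identityʳ a))
                                (sumℕ-cong-≗ {L} (λ x → cong (ε ∘ vertex) (+-suc a (toℕ x))))

    ρ^B-+ : ∀ L a → ρ^ B (a + L) ≡ ρ^ (evensIn a L) (ρ^ B a)
    ρ^B-+ zero    a = cong (ρ^ B) (+-identityʳ a)
    ρ^B-+ (suc L) a = begin
      ρ^ B (a + suc L)                                     ≡⟨ cong (ρ^ B) (+-suc a L) ⟩
      ρ^ B (suc a + L)                                     ≡⟨ ρ^B-+ L (suc a) ⟩
      ρ^ (evensIn (suc a) L) (ρ^ B (suc a))                ≡⟨ cong (ρ^ (evensIn (suc a) L)) (ρ^B-suc a) ⟩
      ρ^ (evensIn (suc a) L) (ρ^ (ε (vertex a)) (ρ^ B a))  ≡⟨ iter-+ ρ (evensIn (suc a) L) (ε (vertex a)) (ρ^ B a) ⟨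
      ρ^ (evensIn (suc a) L + ε (vertex a)) (ρ^ B a)       ≡⟨ cong (λ k → ρ^ k (ρ^ B a)) (+-comm (evensIn (suc a) L) _) ⟩
      ρ^ (ε (vertex a) + evensIn (suc a) L) (ρ^ B a)       ≡⟨ cong (λ k → ρ^ k (ρ^ B a)) (evensIn-suc a L) ⟨
      ρ^ (evensIn a (suc L)) (ρ^ B a)                      ∎

module RationalSums where
  open import Data.Nat as ℕ using (zero; suc; _≤_; z≤n; s≤s)
  import Data.Nat.Properties as ℕP
  import Data.Integer as ℤ
  import Data.Integer.Properties as ℤP
  open import Data.Nat.Coprimality using (1-coprimeTo) renaming (sym to coprime-sym)
  open import Data.Fin as Fin using (zero; suc; toℕ)
  open import Data.Rational using (0ℚ; 1ℚ; _+_; _*_; _-_; -_; toℚᵘ)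
  open import Data.Rational.Properties
    using (+-*-commutativeRing; _≟_; normalize-coprime; toℚᵘ-injective; toℚᵘ-homo-+;
           +-identityˡ; +-identityʳ; +-assoc; +-inverseʳ; *-identityˡ; *-zeroˡ; *-assoc; neg-distrib-+)
  import Data.Rational.Unnormalised as ℚᵘ
  open import Data.Rational.Unnormalised.Properties using (≃-sym; module ≃-Reasoning)
  open import Function using (_∘_)
  open import Relation.Nullary using (yes; no)
  open import Relation.Nullary.Decidable using (dec⇒maybe)
  open import Relation.Binary.PropositionalEquality using (refl; sym; trans; cong; cong₂; module ≡-Reasoning)
  open import Tactic.RingSolver.Core.AlmostCommutativeRing using (AlmostCommutativeRing; fromCommutativeRing)
  open import Tactic.RingSolver using (solve-∀)
  open import Algebra.Bundles using (CommutativeRing)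
  open import Algebra.Properties.Semiring.Sum (CommutativeRing.semiring +-*-commutativeRing)
    using (sum; sum-cong-≗; ∑-distrib-+; ∑-comm; *-distribˡ-sum; *-distribʳ-sum; sum-replicate-zero)
  open import Algebra.Properties.CommutativeMonoid.Sum ℕP.+-0-commutativeMonoid
    using () renaming (sum to sumℕ)
  open Counting using (∑ℕ<)

  ℚ-ring : AlmostCommutativeRing _ _
  ℚ-ring = fromCommutativeRing +-*-commutativeRing (λ x → dec⇒maybe (0ℚ ≟ x))

  toℚᵘ-ℕ→ℚ : ∀ k → toℚᵘ (ℕ→ℚ k) ≡ ℚᵘ.mkℚᵘ (ℤ.+ k) 0
  toℚᵘ-ℕ→ℚ k = cong toℚᵘ (normalize-coprime (coprime-sym (1-coprimeTo k)))

  ℕ→ℚ-suc : ∀ k → ℕ→ℚ (suc k) ≡ 1ℚ + ℕ→ℚ k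
  ℕ→ℚ-suc k = toℚᵘ-injective (begin
    toℚᵘ (ℕ→ℚ (suc k))                             ≡⟨ toℚᵘ-ℕ→ℚ (suc k) ⟩
    ℚᵘ.mkℚᵘ (ℤ.+ suc k) 0                           ≈⟨ ℚᵘ.*≡* numerators ⟩
    ℚᵘ.mkℚᵘ (ℤ.+ 1) 0 ℚᵘ.+ ℚᵘ.mkℚᵘ (ℤ.+ k) 0       ≡⟨ cong (toℚᵘ 1ℚ ℚᵘ.+_) (toℚᵘ-ℕ→ℚ k) ⟨
    toℚᵘ 1ℚ ℚᵘ.+ toℚᵘ (ℕ→ℚ k)                      ≈⟨ ≃-sym (toℚᵘ-homo-+ 1ℚ (ℕ→ℚ k)) ⟩
    toℚᵘ (1ℚ + ℕ→ℚ k)                               ∎)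
    where
    open ≃-Reasoning
    numerators : ℤ.+ suc k ℤ.* ℤ.+ 1 ≡ (ℤ.+ 1 ℤ.+ ℤ.+ k ℤ.* ℤ.+ 1) ℤ.* ℤ.+ 1
    numerators = trans (ℤP.*-identityʳ _)
                       (sym (trans (ℤP.*-identityʳ _) (cong (ℤ._+_ (ℤ.+ 1)) (ℤP.*-identityʳ (ℤ.+ k)))))

  ℕ→ℚ-+ : ∀ a b → ℕ→ℚ (a ℕ.+ b) ≡ ℕ→ℚ a + ℕ→ℚ b
  ℕ→ℚ-+ zero    b = sym (+-identityˡ (ℕ→ℚ b))
  ℕ→ℚ-+ (suc a) b = begin
    ℕ→ℚ (suc (a ℕ.+ b))        ≡⟨ ℕ→ℚ-suc (a ℕ.+ b) ⟩
    1ℚ + ℕ→ℚ (a ℕ.+ b)         ≡⟨ cong (1ℚ +_) (ℕ→ℚ-+ a b) ⟩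
    1ℚ + (ℕ→ℚ a + ℕ→ℚ b)       ≡⟨ +-assoc 1ℚ (ℕ→ℚ a) (ℕ→ℚ b) ⟨
    1ℚ + ℕ→ℚ a + ℕ→ℚ b         ≡⟨ cong (_+ ℕ→ℚ b) (ℕ→ℚ-suc a) ⟨
    ℕ→ℚ (suc a) + ℕ→ℚ b        ∎
    where open ≡-Reasoning

  ℕ→ℚ-sum : ∀ {m} (f : Fin m → ℕ) → ℕ→ℚ (sumℕ f) ≡ sum (ℕ→ℚ ∘ f)
  ℕ→ℚ-sum {zero}  f = refl
  ℕ→ℚ-sum {suc m} f =
    trans (ℕ→ℚ-+ (f zero) (sumℕ (f ∘ suc))) (cong (ℕ→ℚ (f zero) +_) (ℕ→ℚ-sum (f ∘ suc)))

  sumℚ≡sum : ∀ {m} (f : Fin m → ℚ) → sumℚ f ≡ sum f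
  sumℚ≡sum {zero}  f = refl
  sumℚ≡sum {suc m} f = cong (f zero +_) (sumℚ≡sum (f ∘ suc))

  sum-neg : ∀ {m} (f : Fin m → ℚ) → sum (λ k → - f k) ≡ - sum f
  sum-neg {zero}  f = refl
  sum-neg {suc m} f =
    trans (cong (- f zero +_) (sum-neg (f ∘ suc))) (sym (neg-distrib-+ (f zero) (sum (f ∘ suc))))

  sum-- : ∀ {m} (f g : Fin m → ℚ) → sum (λ k → f k - g k) ≡ sum f - sum g
  sum-- f g = trans (∑-distrib-+ f (λ k → - g k)) (cong (sum f +_) (sum-neg g))

  ∑< : ℕ → (ℕ → ℚ) → ℚ
  ∑< L f = sum (λ (x : Fin L) → f (toℕ x))

  ∑<-+ : ∀ y L f → ∑< (y ℕ.+ L) f ≡ ∑< y f + ∑< L (λ x → f (y ℕ.+ x))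
  ∑<-+ zero    L f = sym (+-identityˡ (∑< L f))
  ∑<-+ (suc y) L f = trans (cong (f 0 +_) (∑<-+ y L (f ∘ suc))) (sym (+-assoc (f 0) _ _))

  ∑<-suc : ∀ L f → ∑< (suc L) f ≡ ∑< L f + f L
  ∑<-suc zero    f = trans (+-identityʳ (f 0)) (sym (+-identityˡ (f 0)))
  ∑<-suc (suc L) f = trans (cong (f 0 +_) (∑<-suc L (f ∘ suc))) (sym (+-assoc (f 0) _ _))

  ∑<-telescope : ∀ L (F : ℕ → ℚ) → ∑< L (λ x → F (suc x) - F x) ≡ F L - F 0
  ∑<-telescope zero    F = sym (+-inverseʳ (F 0))
  ∑<-telescope (suc L) F =
    trans (cong ((F 1 - F 0) +_) (∑<-telescope L (F ∘ suc))) (chain (F 0) (F 1) (F (suc L)))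
    where
    chain : ∀ a b c → (b - a) + (c - b) ≡ c - a
    chain = solve-∀ ℚ-ring

  ∑<-reindex : ∀ (w : ℕ → ℕ) → (∀ x → w x ≤ 1) → ∀ L (g : ℕ → ℚ) →
               ∑< L (λ x → ℕ→ℚ (w x) * g (∑ℕ< x w)) ≡ ∑< (∑ℕ< L w) g
  ∑<-reindex w w≤1 zero    g = refl
  ∑<-reindex w w≤1 (suc L) g =
    trans (cong (ℕ→ℚ (w 0) * g 0 +_) (∑<-reindex (w ∘ suc) (w≤1 ∘ suc) L (λ t → g (w 0 ℕ.+ t))))
          (head (w 0) (w≤1 0))
    where
    W : ℕ
    W = ∑ℕ< L (w ∘ suc)
    head : ∀ e → e ≤ 1 → ℕ→ℚ e * g 0 + ∑< W (λ t → g (e ℕ.+ t)) ≡ ∑< (e ℕ.+ W) g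
    head zero          z≤n       = trans (cong (_+ ∑< W g) (*-zeroˡ (g 0))) (+-identityˡ (∑< W g))
    head (suc zero)    (s≤s z≤n) = cong (_+ ∑< W (g ∘ suc)) (*-identityˡ (g 0))
    head (suc (suc _)) (s≤s ())

  indicator-step : ∀ {A : Set} (f : A → A) (F : A → ℚ) {e} → e ≤ 1 → ∀ z →
                   ℕ→ℚ e * (F (f z) - F z) ≡ F (iter f e z) - F z
  indicator-step f F z≤n       z = trans (*-zeroˡ (F (f z) - F z)) (sym (+-inverseʳ (F z)))
  indicator-step f F (s≤s z≤n) z = *-identityˡ (F (f z) - F z)

  _·_ : ∀ {m} → (Fin m → ℚ) → (Fin m → ℚ) → ℚ
  u · v = sum (λ k → u k * v k)

  ⊛≡· : ∀ {m} (A B : Matrix m) i j → (A ⊛ B) i j ≡ A i · (λ k → B k j)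
  ⊛≡· A B i j = sumℚ≡sum (λ k → A i k * B k j)

  identity-suc : ∀ {m} (v k : Fin m) → identity (suc v) (suc k) ≡ identity v k
  identity-suc v k with v Fin.≟ k
  ... | yes _ = refl
  ... | no  _ = refl

  identity-· : ∀ {m} (v : Fin m) (X : Fin m → ℚ) → identity v · X ≡ X v
  identity-· {suc m} zero X = begin
    1ℚ * X zero + sum (λ k → 0ℚ * X (suc k))
      ≡⟨ cong₂ _+_ (*-identityˡ (X zero)) (sum-cong-≗ {m} (λ k → *-zeroˡ (X (suc k)))) ⟩
    X zero + sum (λ (_ : Fin m) → 0ℚ)         ≡⟨ cong (X zero +_) (sum-replicate-zero m) ⟩
    X zero + 0ℚ                               ≡⟨ +-identityʳ (X zero) ⟩
    X zero                                    ∎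
    where open ≡-Reasoning
  identity-· {suc m} (suc v) X = begin
    0ℚ * X zero + sum (λ k → identity (suc v) (suc k) * X (suc k))
      ≡⟨ cong₂ _+_ (*-zeroˡ (X zero)) (sum-cong-≗ {m} (λ k → cong (_* X (suc k)) (identity-suc v k))) ⟩
    0ℚ + identity v · (X ∘ suc)  ≡⟨ +-identityˡ (identity v · (X ∘ suc)) ⟩
    identity v · (X ∘ suc)       ≡⟨ identity-· v (X ∘ suc) ⟩
    X (suc v)                    ∎
    where open ≡-Reasoning

  difference-· : ∀ {m} (u w X : Fin m → ℚ) → (λ k → u k - w k) · X ≡ u · X - w · X
  difference-· {m} u w X =
    trans (sum-cong-≗ {m} (λ k → distrib (u k) (w k) (X k))) (sum-- (λ k → u k * X k) (λ k → w k * X k))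
    where
    distrib : ∀ a b x → (a - b) * x ≡ a * x - b * x
    distrib = solve-∀ ℚ-ring

  scaled-· : ∀ {m} q (u X : Fin m → ℚ) → (λ k → q * u k) · X ≡ q * (u · X)
  scaled-· {m} q u X =
    trans (sum-cong-≗ {m} (λ k → *-assoc q (u k) (X k))) (sym (*-distribˡ-sum q (λ k → u k * X k)))

  ∑<-· : ∀ {m} L (u : ℕ → Fin m → ℚ) (X : Fin m → ℚ) →
         (λ k → ∑< L (λ x → u x k)) · X ≡ ∑< L (λ x → u x · X)
  ∑<-· {m} L u X = trans (sum-cong-≗ {m} (λ k → *-distribʳ-sum (X k) (λ (x : Fin L) → u (toℕ x) k)))
                         (∑-comm {m} {L} (λ k x → u (toℕ x) k * X k))

module CartanInverse {n : ℕ} .{{_ : NonZero n}} (c : Fin n → ℕ) (c-pos : ∀ i → 0 < c i)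
    (pd : Fin n → ℕ) (pd-res : ∀ i → PD c i 1 (pd i)) (B : ℕ) (pd≤B : ∀ i → pd i ≤ B) where
  open import Data.Nat as ℕ using (zero; suc)
  import Data.Nat.Properties as ℕP
  open import Data.Fin as Fin using (toℕ)
  open import Data.Rational using (0ℚ; 1ℚ; _+_; _*_; _-_)
  open import Data.Rational.Properties using (+-*-commutativeRing; +-comm; +-identityʳ; *-identityʳ)
  open import Function using (_∘_)
  open import Relation.Nullary using (yes; no)
  open import Relation.Binary.PropositionalEquality using (refl; sym; trans; cong; cong₂; subst; module ≡-Reasoning)
  open import Tactic.RingSolver using (solve-∀)
  open import Algebra.Bundles using (CommutativeRing)
  open import Algebra.Properties.Semiring.Sum (CommutativeRing.semiring +-*-commutativeRing)
    using (sum; sum-cong-≗; ∑-comm; sum-replicate-zero)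
  open import Algebra.Properties.CommutativeMonoid.Sum ℕP.+-0-commutativeMonoid
    using () renaming (sum to sumℕ)
  open Iteration using (iter-suc)
  open Counting using (∑ℕ<; evenIndicator≤1; countEven≡sum)
  open RationalSums
  open Cover c
  open Inflationary c-pos
  open Resolutions pd pd-res B pd≤B
  open ≡-Reasoning

  C : Matrix n
  C = toℚMatrix (cartan c)

  res^ : ℕ → Fin n → Fin n
  res^ = iter (resStep c)

  x-[x-y]≡y : ∀ x y → x - (x - y) ≡ y
  x-[x-y]≡y = solve-∀ ℚ-ring

  -- Row i is the class of S_i in the basis of indecomposable projectives, read off its minimal
  -- projective resolution, whose terms are P_(res^ m i) and P_(res^ m (i+1)).  After B steps the
  -- two sequences have merged, or stay one step apart when pd S_i is even: hence the ε i term.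
  inverseCartan : Matrix n
  inverseCartan i j = ℕ→ℚ (ε i) * identity (res^ B i) j
                      - ∑< B (λ m → identity (res^ m (shift i 1)) j - identity (res^ m i) j)

  inverseCartan-· : ∀ i X → inverseCartan i · X
                    ≡ ℕ→ℚ (ε i) * X (res^ B i) - ∑< B (λ m → X (res^ m (shift i 1)) - X (res^ m i))
  inverseCartan-· i X = begin
    inverseCartan i · X
      ≡⟨ difference-· (λ k → q * identity (res^ B i) k) (λ k → ∑< B (λ m → next m k - here m k)) X ⟩
    (λ k → q * identity (res^ B i) k) · X - (λ k → ∑< B (λ m → next m k - here m k)) · X
      ≡⟨ cong₂ _-_ (scaled-· q (identity (res^ B i)) X) (∑<-· B (λ m k → next m k - here m k) X) ⟩
    q * (identity (res^ B i) · X) - ∑< B (λ m → (λ k → next m k - here m k) · X)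
      ≡⟨ cong₂ (λ p r → q * p - r) (identity-· (res^ B i) X)
               (sum-cong-≗ {B} (λ m → difference-· (next (toℕ m)) (here (toℕ m)) X)) ⟩
    q * X (res^ B i) - ∑< B (λ m → next m · X - here m · X)
      ≡⟨ cong (q * X (res^ B i) -_)
              (sum-cong-≗ {B} (λ m → cong₂ _-_ (identity-· (res^ (toℕ m) (shift i 1)) X)
                                               (identity-· (res^ (toℕ m) i) X))) ⟩
    q * X (res^ B i) - ∑< B (λ m → X (res^ m (shift i 1)) - X (res^ m i)) ∎
    where
    q : ℚ
    q = ℕ→ℚ (ε i)
    next here : ℕ → Fin n → ℚ
    next m = identity (res^ m (shift i 1))
    here m = identity (res^ m i)

  res^-vertex-suc : ∀ m y → res^ m (shift (vertex y) 1) ≡ vertex (ρ^ m (suc y))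
  res^-vertex-suc m y = trans (cong (res^ m) (trans (sym (vertex-+ y 1)) (cong vertex (ℕP.+-comm y 1))))
                              (iter-resStep-vertex m (suc y))

  countHits-suc : ∀ i j L → ℕ→ℚ (countHits i j (suc L)) ≡ ℕ→ℚ (countHits i j L) + identity (shift i L) j
  countHits-suc i j L with shift i L Fin.≟ j
  ... | yes _ = trans (ℕ→ℚ-suc (countHits i j L)) (+-comm 1ℚ (ℕ→ℚ (countHits i j L)))
  ... | no  _ = sym (+-identityʳ (ℕ→ℚ (countHits i j L)))

  countHits-∑ : ∀ i j L → ℕ→ℚ (countHits i j L) ≡ ∑< L (λ x → identity (shift i x) j)
  countHits-∑ i j zero    = refl
  countHits-∑ i j (suc L) = begin
    ℕ→ℚ (countHits i j (suc L))                              ≡⟨ countHits-suc i j L ⟩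
    ℕ→ℚ (countHits i j L) + identity (shift i L) j           ≡⟨ cong (_+ identity (shift i L) j) (countHits-∑ i j L) ⟩
    ∑< L (λ x → identity (shift i x) j) + identity (shift i L) j ≡⟨ ∑<-suc L (λ x → identity (shift i x) j) ⟨
    ∑< (suc L) (λ x → identity (shift i x) j)                ∎

  C-· : ∀ i Y → C i · Y ≡ ∑< (c i) (λ x → Y (shift i x))
  C-· i Y = begin
    C i · Y
      ≡⟨ sum-cong-≗ {n} (λ k → cong (_* Y k) (countHits-∑ i k (c i))) ⟩
    (λ k → ∑< (c i) (λ x → identity (shift i x) k)) · Y
      ≡⟨ ∑<-· (c i) (λ x → identity (shift i x)) Y ⟩
    ∑< (c i) (λ x → identity (shift i x) · Y)
      ≡⟨ sum-cong-≗ {c i} (λ x → identity-· (shift i (toℕ x)) Y) ⟩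
    ∑< (c i) (λ x → Y (shift i x))
      ∎

  module _ (j : Fin n) where

    e : ℕ → ℚ
    e y = identity (vertex y) j

    Φ : ℕ → ℚ
    Φ y = ∑< y e

    Φ-suc : ∀ a → Φ (suc a) - Φ a ≡ e a
    Φ-suc a = trans (cong (_- Φ a) (∑<-suc a e)) (cancel (Φ a) (e a))
      where
      cancel : ∀ x y → (x + y) - x ≡ y
      cancel = solve-∀ ℚ-ring

    cartan-vertex : ∀ y → ℕ→ℚ (cartan c (vertex y) j) ≡ Φ (ρ y) - Φ y
    cartan-vertex y = begin
      ℕ→ℚ (countHits (vertex y) j L)                ≡⟨ countHits-∑ (vertex y) j L ⟩
      ∑< L (λ x → identity (shift (vertex y) x) j)  ≡⟨ sum-cong-≗ {L} (λ x → cong (λ v → identity v j) (vertex-+ y (toℕ x))) ⟨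
      ∑< L (λ x → e (y ℕ.+ x))                       ≡⟨ uncancel (Φ y) (∑< L (λ x → e (y ℕ.+ x))) ⟩
      (Φ y + ∑< L (λ x → e (y ℕ.+ x))) - Φ y         ≡⟨ cong (_- Φ y) (∑<-+ y L e) ⟨
      Φ (ρ y) - Φ y                                  ∎
      where
      L : ℕ
      L = c (vertex y)
      uncancel : ∀ x y → y ≡ (x + y) - x
      uncancel = solve-∀ ℚ-ring

    cartan-column : ∀ m y → ℕ→ℚ (cartan c (res^ m (vertex y)) j) ≡ Φ (ρ^ (suc m) y) - Φ (ρ^ m y)
    cartan-column m y =
      trans (cong (λ v → ℕ→ℚ (cartan c v j)) (iter-resStep-vertex m y)) (cartan-vertex (ρ^ m y))

    inverseCartan-vertex : ∀ y → inverseCartan (vertex y) j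
                           ≡ ℕ→ℚ (ε (vertex y)) * e (ρ^ B y) - ∑< B (λ m → e (ρ^ m (suc y)) - e (ρ^ m y))
    inverseCartan-vertex y =
      cong₂ (λ p q → ℕ→ℚ (ε (vertex y)) * p - q) (cong (λ v → identity v j) (iter-resStep-vertex B y))
        (sum-cong-≗ {B} (λ m → cong₂ _-_ (cong (λ v → identity v j) (res^-vertex-suc (toℕ m) y))
                                         (cong (λ v → identity v j) (iter-resStep-vertex (toℕ m) y))))

    inverseCartan⊛C-vertex : ∀ a → (inverseCartan ⊛ C) (vertex a) j ≡ identity (vertex a) j
    inverseCartan⊛C-vertex a = begin
      (inverseCartan ⊛ C) (vertex a) j
        ≡⟨ ⊛≡· inverseCartan C (vertex a) j ⟩
      inverseCartan (vertex a) · X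
        ≡⟨ inverseCartan-· (vertex a) X ⟩
      ℕ→ℚ εa * X (res^ B (vertex a)) - ∑< B (λ m → X (res^ m (shift (vertex a) 1)) - X (res^ m (vertex a)))
        ≡⟨ cong₂ (λ p q → ℕ→ℚ εa * p - q) (cartan-column B a)
                 (sum-cong-≗ {B} (λ m → cong₂ _-_ (trans (cong X (res^-vertex-suc (toℕ m) a))
                                                         (cartan-vertex (ρ^ (toℕ m) (suc a))))
                                                  (cartan-column (toℕ m) a))) ⟩
      ℕ→ℚ εa * (Φ (ρ (ρ^ B a)) - Φ (ρ^ B a))
        - ∑< B (λ m → (Φ (ρ^ (suc m) (suc a)) - Φ (ρ^ m (suc a))) - (Φ (ρ^ (suc m) a) - Φ (ρ^ m a)))
        ≡⟨ cong₂ _-_ (indicator-step ρ Φ (evenIndicator≤1 (pd (vertex a))) (ρ^ B a))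
                     (trans (sum-cong-≗ {B} (λ m → regroup (toℕ m))) (∑<-telescope B F)) ⟩
      (Φ (ρ^ εa (ρ^ B a)) - Φ (ρ^ B a)) - (F B - F 0)
        ≡⟨ cong (λ z → (Φ z - Φ (ρ^ B a)) - (F B - F 0)) (ρ^B-suc a) ⟨
      F B - (F B - (Φ (suc a) - Φ a))
        ≡⟨ x-[x-y]≡y (F B) (Φ (suc a) - Φ a) ⟩
      Φ (suc a) - Φ a
        ≡⟨ Φ-suc a ⟩
      identity (vertex a) j ∎
      where
      X : Fin n → ℚ
      X k = C k j
      εa : ℕ
      εa = ε (vertex a)
      F : ℕ → ℚ
      F m = Φ (ρ^ m (suc a)) - Φ (ρ^ m a)
      regroup : ∀ m → (Φ (ρ^ (suc m) (suc a)) - Φ (ρ^ m (suc a))) - (Φ (ρ^ (suc m) a) - Φ (ρ^ m a))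
                      ≡ F (suc m) - F m
      regroup m = rearrange (Φ (ρ^ (suc m) (suc a))) (Φ (ρ^ m (suc a))) (Φ (ρ^ (suc m) a)) (Φ (ρ^ m a))
        where
        rearrange : ∀ p' q' p q → (p' - q') - (p - q) ≡ (p' - p) - (q' - q)
        rearrange = solve-∀ ℚ-ring

    projective-has-one-even-factor : ∀ a → evensIn a (c (vertex a)) ≡ 1
    projective-has-one-even-factor a =
      ρ^-injectiveˡ (ρ^ B a) (trans (sym (ρ^B-+ (c (vertex a)) a)) (iter-suc ρ B a))

    even-factors-of-projective : ∀ a →
      ∑< (c (vertex a)) (λ x → ℕ→ℚ (ε (vertex (a ℕ.+ x))) * e (ρ^ B (a ℕ.+ x))) ≡ e (ρ^ B a)
    even-factors-of-projective a = begin
      ∑< L (λ x → ℕ→ℚ (w x) * e (ρ^ B (a ℕ.+ x)))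
        ≡⟨ sum-cong-≗ {L} (λ x → cong (λ z → ℕ→ℚ (w (toℕ x)) * e z) (ρ^B-+ (toℕ x) a)) ⟩
      ∑< L (λ x → ℕ→ℚ (w x) * g (∑ℕ< x w))
        ≡⟨ ∑<-reindex w (λ x → evenIndicator≤1 (pd (vertex (a ℕ.+ x)))) L g ⟩
      ∑< (evensIn a L) g
        ≡⟨ cong (λ k → ∑< k g) (projective-has-one-even-factor a) ⟩
      g 0 + 0ℚ
        ≡⟨ +-identityʳ (g 0) ⟩
      e (ρ^ B a)
        ∎
      where
      L : ℕ
      L = c (vertex a)
      w : ℕ → ℕ
      w x = ε (vertex (a ℕ.+ x))
      g : ℕ → ℚ
      g t = e (ρ^ t (ρ^ B a))

    C⊛inverseCartan-vertex : ∀ a → (C ⊛ inverseCartan) (vertex a) j ≡ identity (vertex a) j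
    C⊛inverseCartan-vertex a = begin
      (C ⊛ inverseCartan) (vertex a) j
        ≡⟨ ⊛≡· C inverseCartan (vertex a) j ⟩
      C (vertex a) · (λ k → inverseCartan k j)
        ≡⟨ C-· (vertex a) (λ k → inverseCartan k j) ⟩
      ∑< L (λ x → inverseCartan (shift (vertex a) x) j)
        ≡⟨ sum-cong-≗ {L} (λ x → trans (cong (λ v → inverseCartan v j) (sym (vertex-+ a (toℕ x))))
                                        (inverseCartan-vertex (a ℕ.+ toℕ x))) ⟩
      ∑< L (λ x → even-term x - ∑< B (λ m → step m x))
        ≡⟨ sum-- {L} (λ x → even-term (toℕ x)) (λ x → ∑< B (λ m → step m (toℕ x))) ⟩
      ∑< L even-term - ∑< L (λ x → ∑< B (λ m → step m x))
        ≡⟨ cong₂ _-_ (even-factors-of-projective a) (∑-comm {L} {B} (λ x m → step (toℕ m) (toℕ x))) ⟩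
      e (ρ^ B a) - ∑< B (λ m → ∑< L (step m))
        ≡⟨ cong (e (ρ^ B a) -_) (trans (sum-cong-≗ {B} (λ m → column-telescope (toℕ m)))
                                       (∑<-telescope B (λ m → e (ρ^ m a)))) ⟩
      e (ρ^ B a) - (e (ρ^ B a) - e a)
        ≡⟨ x-[x-y]≡y (e (ρ^ B a)) (e a) ⟩
      e a ∎
      where
      L : ℕ
      L = c (vertex a)
      even-term : ℕ → ℚ
      even-term x = ℕ→ℚ (ε (vertex (a ℕ.+ x))) * e (ρ^ B (a ℕ.+ x))
      step : ℕ → ℕ → ℚ
      step m x = e (ρ^ m (suc (a ℕ.+ x))) - e (ρ^ m (a ℕ.+ x))
      column-telescope : ∀ m → ∑< L (step m) ≡ e (ρ^ (suc m) a) - e (ρ^ m a)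
      column-telescope m = begin
        ∑< L (step m)
          ≡⟨ sum-cong-≗ {L} (λ x → cong (λ z → e (ρ^ m z) - F (toℕ x)) (ℕP.+-suc a (toℕ x))) ⟨
        ∑< L (λ x → F (suc x) - F x)  ≡⟨ ∑<-telescope L F ⟩
        F L - F 0                     ≡⟨ cong₂ _-_ (cong e (iter-suc ρ m a)) (cong (e ∘ ρ^ m) (ℕP.+-identityʳ a)) ⟩
        e (ρ^ (suc m) a) - e (ρ^ m a) ∎
        where
        F : ℕ → ℚ
        F x = e (ρ^ m (a ℕ.+ x))

  inverseCartan-rowSum : ∀ i → sumℚ (inverseCartan i) ≡ ℕ→ℚ (ε i)
  inverseCartan-rowSum i = begin
    sumℚ (inverseCartan i)                     ≡⟨ sumℚ≡sum (inverseCartan i) ⟩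
    sum (inverseCartan i)                      ≡⟨ sum-cong-≗ {n} (λ k → *-identityʳ (inverseCartan i k)) ⟨
    inverseCartan i · (λ _ → 1ℚ)               ≡⟨ inverseCartan-· i (λ _ → 1ℚ) ⟩
    ℕ→ℚ (ε i) * 1ℚ - ∑< B (λ _ → 1ℚ - 1ℚ)     ≡⟨ cong₂ _-_ (*-identityʳ (ℕ→ℚ (ε i))) (sum-replicate-zero B) ⟩
    ℕ→ℚ (ε i) - 0ℚ                             ≡⟨ +-identityʳ (ℕ→ℚ (ε i)) ⟩
    ℕ→ℚ (ε i)                                  ∎

  entrySum-inverseCartan : entrySum inverseCartan ≡ ℕ→ℚ (countEven pd)
  entrySum-inverseCartan = begin
    sumℚ (λ i → sumℚ (inverseCartan i))  ≡⟨ sumℚ≡sum (λ i → sumℚ (inverseCartan i)) ⟩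
    sum (λ i → sumℚ (inverseCartan i))   ≡⟨ sum-cong-≗ {n} inverseCartan-rowSum ⟩
    sum (λ i → ℕ→ℚ (ε i))               ≡⟨ ℕ→ℚ-sum ε ⟨
    ℕ→ℚ (sumℕ ε)                        ≡⟨ cong ℕ→ℚ (countEven≡sum pd) ⟨
    ℕ→ℚ (countEven pd)                  ∎

  inverseCartan⊛C : ∀ i j → (inverseCartan ⊛ C) i j ≡ identity i j
  inverseCartan⊛C i j =
    subst (λ v → (inverseCartan ⊛ C) v j ≡ identity v j) (vertex-toℕ i) (inverseCartan⊛C-vertex j (toℕ i))

  C⊛inverseCartan : ∀ i j → (C ⊛ inverseCartan) i j ≡ identity i j
  C⊛inverseCartan i j =
    subst (λ v → (C ⊛ inverseCartan) v j ≡ identity v j) (vertex-toℕ i) (C⊛inverseCartan-vertex j (toℕ i))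

module CyclicVertices {n : ℕ} .{{_ : NonZero n}} (c : Fin n → ℕ) (c-pos : ∀ i → 0 < c i)
    (pd : Fin n → ℕ) (pd-res : ∀ i → PD c i 1 (pd i)) (B : ℕ) (pd≤B : ∀ i → pd i ≤ B) where
  open import Data.Nat using (_+_; _∸_; >-nonZero; >-nonZero⁻¹)
  open import Data.Nat.Properties as ℕP using (<-≤-trans; <⇒≤; <⇒≢; m<m+n; m+[n∸m]≡n; +-monoˡ-≤; n≢0⇒n>0; z≤′n)
  open import Data.Nat.DivMod using (m%n<n)
  open import Data.Fin using (toℕ)
  open import Data.Product using (_,_)
  open import Function.Bundles using (mk⇔)
  open import Relation.Binary.PropositionalEquality using (refl; sym; trans; cong; subst; _≢_; module ≡-Reasoning)
  open import Algebra.Properties.CommutativeMonoid.Sum ℕP.+-0-commutativeMonoid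
    using () renaming (sum-cong-≗ to sumℕ-cong-≗)
  open Iteration
  open Counting using (image; ∈-image⁺; ∈-image⁻; ∣image∣; countEven≡sum)
  open Cover c
  open Inflationary c-pos
  open Resolutions pd pd-res B pd≤B
  open ≡-Reasoning

  s : ℕ
  s = evensIn 0 n

  s≡countEven : s ≡ countEven pd
  s≡countEven = trans (sumℕ-cong-≗ {n} (λ i → cong ε (vertex-toℕ i))) (sym (countEven≡sum pd))

  y₀ : ℕ
  y₀ = ρ^ B 0

  ρ^s-y₀ : ρ^ s y₀ ≡ y₀ + n
  ρ^s-y₀ = trans (sym (ρ^B-+ n 0)) (ρ^-+n B 0)

  s-pos : 0 < s
  s-pos = n≢0⇒n>0 (λ s≡0 → <⇒≢ (m<m+n y₀ (>-nonZero⁻¹ n))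
                                  (trans (cong (λ k → ρ^ k y₀) (sym s≡0)) ρ^s-y₀))

  instance
    s-nonZero : NonZero s
    s-nonZero = >-nonZero s-pos

  orbit : ℕ → Fin n
  orbit t = iter (resStep c) t (vertex y₀)

  orbit-vertex : ∀ t → orbit t ≡ vertex (ρ^ t y₀)
  orbit-vertex t = iter-resStep-vertex t y₀

  orbit-periodic : orbit s ≡ vertex y₀
  orbit-periodic = trans (orbit-vertex s) (trans (cong vertex ρ^s-y₀) (vertex-+n y₀))

  -- The lifts ρ^ t y₀ (t < s) lie in the window [y₀, y₀ + n).
  orbit-injective : ∀ {t t'} → t < t' → t' < s → orbit t ≢ orbit t'
  orbit-injective {t} {t'} t<t' t'<s eq =
    <⇒≢ lifts< (vertex-injective-window (<⇒≤ lifts<) lift'<lift+n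
                  (trans (sym (orbit-vertex t)) (trans eq (orbit-vertex t'))))
    where
    lifts< : ρ^ t y₀ < ρ^ t' y₀
    lifts< = ρ^-monoˡ-< y₀ t<t'
    lift'<lift+n : ρ^ t' y₀ < ρ^ t y₀ + n
    lift'<lift+n = <-≤-trans (subst (ρ^ t' y₀ <_) ρ^s-y₀ (ρ^-monoˡ-< y₀ t'<s))
                            (+-monoˡ-≤ n (ρ^-monoˡ-≤ {m' = t} y₀ z≤′n))

  flows-into-orbit : ∀ i → iter (resStep c) B i ≡ orbit (evensIn 0 (toℕ i))
  flows-into-orbit i = begin
    iter (resStep c) B i                  ≡⟨ cong (iter (resStep c) B) (vertex-toℕ i) ⟨
    iter (resStep c) B (vertex (toℕ i))   ≡⟨ iter-resStep-vertex B (toℕ i) ⟩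
    vertex (ρ^ B (toℕ i))                 ≡⟨ cong vertex (ρ^B-+ (toℕ i) 0) ⟩
    vertex (ρ^ (evensIn 0 (toℕ i)) y₀)    ≡⟨ orbit-vertex (evensIn 0 (toℕ i)) ⟨
    orbit (evensIn 0 (toℕ i))             ∎

  OnCycle⇒orbit : ∀ {i} → OnCycle c i → ∃ λ r → orbit r ≡ i
  OnCycle⇒orbit {i} (m , cycle) with iter-returns (resStep c) {m} {i} cycle B
  ... | r , returns = r + k , (begin
    orbit (r + k)                               ≡⟨ iter-+ (resStep c) r k (vertex y₀) ⟩
    iter (resStep c) r (orbit k)                ≡⟨ cong (iter (resStep c) r) (flows-into-orbit i) ⟨
    iter (resStep c) r (iter (resStep c) B i)   ≡⟨ returns ⟩
    i                                           ∎)
    where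
    k : ℕ
    k = evensIn 0 (toℕ i)

  cyclicVertices : Subset n
  cyclicVertices = image orbit s

  ∈cyclicVertices⇔OnCycle : ∀ i → i ∈ cyclicVertices ⇔ OnCycle c i
  ∈cyclicVertices⇔OnCycle i = mk⇔ to from
    where
    to : i ∈ cyclicVertices → OnCycle c i
    to i∈ with ∈-image⁻ {f = orbit} {s = s} i∈
    ... | t , _ , refl = s ∸ 1 , subst (λ p → iter (resStep c) p (orbit t) ≡ orbit t) (sym (m+[n∸m]≡n s-pos))
                                       (iter-fixed-orbit (resStep c) {s} {vertex y₀} orbit-periodic t)
    from : OnCycle c i → i ∈ cyclicVertices
    from cycle with OnCycle⇒orbit cycle
    ... | r , refl = subst (_∈ cyclicVertices) (sym (iter-%-fixed (resStep c) {s} {vertex y₀} orbit-periodic r))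
                           (∈-image⁺ {f = orbit} (m%n<n r s))

  ∣cyclicVertices∣ : ∣ cyclicVertices ∣ ≡ countEven pd
  ∣cyclicVertices∣ = trans (∣image∣ orbit-injective) s≡countEven

Kupisch⇒positive : ∀ {n} .{{_ : NonZero n}} {c : Fin n → ℕ} → Kupisch c → ∀ i → 0 < c i
Kupisch⇒positive (cyclic c≥2 _) i = ≤-trans (s≤s z≤n) (c≥2 i)
Kupisch⇒positive {n} (linear c≥2 c≡1 _) i with suc (toℕ i) <? n
... | yes i+1<n = ≤-trans (s≤s z≤n) (c≥2 i i+1<n)
... | no  i+1≮n = ≤-reflexive (sym (c≡1 i (≤-antisym (toℕ<n i) (≮⇒≥ i+1≮n))))

proposition4p2 : (n : ℕ) .{{_ : NonZero n}} (c : Fin n → ℕ) → Kupisch c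
    → (pd : Fin n → ℕ) → (∀ i → PD c i 1 (pd i))
    → Σ (Matrix n) λ M → IsInverse (toℚMatrix (cartan c)) M
        × entrySum M ≡ ℕ→ℚ (countEven pd)
        × ∃ λ (S : Subset n) → (∀ i → (i ∈ S) ⇔ OnCycle c i) × entrySum M ≡ ℕ→ℚ ∣ S ∣
proposition4p2 n c kupisch pd pd-res =
  inverseCartan , (C⊛inverseCartan , inverseCartan⊛C) , entrySum-inverseCartan ,
  cyclicVertices , ∈cyclicVertices⇔OnCycle ,
  trans entrySum-inverseCartan (cong ℕ→ℚ (sym ∣cyclicVertices∣))
  where
  B : ℕ
  B = max 0 (List.tabulate pd)
  pd≤B : ∀ i → pd i ≤ B
  pd≤B = tabulate⁻ (xs≤max 0 (List.tabulate pd))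
  open CartanInverse c (Kupisch⇒positive kupisch) pd pd-res B pd≤B
  open CyclicVertices c (Kupisch⇒positive kupisch) pd pd-res B pd≤B
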